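{- Let $S_0,S,S'$ be finite sets of pairs $(p,q)$ with $p$ a state of the transducer $\mathcal{T}$ and $q$ a node of the table, and let $a\in\Sigma$. If $S_0\xrightarrow{*}S'\xrightarrow{*}S\xrightarrow{a}S'$ and $L(S_0)$ is weakly acyclic, then $L(S)=L(S')$.
   Context: Fix a finite alphabet $\Sigma$. A table consists of nodes $q$, each with a successor $q^a$ for each $a\in\Sigma$ which is either the special symbol $\mathrm{self}$ or another node, and an acceptance flag; its language $L(q)\subseteq\Sigma^*$ is defined recursively: the empty word is in $L(q)$ iff the flag is $1$, and $aw\in L(q)$ iff either $q^a=\mathrm{self}$ and $w\in L(q)$, or $q^a\neq\mathrm{self}$ and $w\in L(q^a)$. Define $\mathrm{succ}(q,b):=q^b$ if $q^b\neq\mathrm{self}$ and $\mathrm{succ}(q,b):=q$ otherwise. A transducer is an NFA $\mathcal{T}=(P,\Sigma\times\Sigma,\delta,p_0,F)$; for a state $p$, $L(p)\subseteq\Sigma^*\times\Sigma^*$ is the set of pairs $(a_1\cdots a_n,b_1\cdots b_n)$ such that $(a_1,b_1)\cdots(a_n,b_n)$ is accepted from $p$. $\mathrm{Pre}(R,L):=\{u: (u,v)\in R,\ v\in L\}$, and for a set $S$ of pairs, $L(S):=\bigcup_{(p,q)\in S}\mathrm{Pre}(L(p),L(q))$. For $a\in\Sigma$, $S\xrightarrow{a}S'$ where $S':=\{(p',\mathrm{succ}(q,b)) : (p,q)\in S,\ b\in\Sigma,\ p'\in\delta(p,(a,b))\}$; $\xrightarrow{*}$ means $\xrightarrow{w}$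 for some word $w$, where $S\xrightarrow{\varepsilon}S$ and $S\xrightarrow{a_1\cdots a_n}S'$ means $S=S_0\xrightarrow{a_1}S_1\cdots\xrightarrow{a_n}S_n=S'$. A DFA $(Q,\Sigma,\delta',q_0,F')$ is weakly acyclic if for every $q\in Q$, nonempty word $w$ and letter $c$ occurring in $w$, $\delta'(q,w)=q$ implies $\delta'(q,c)=q$; a language is weakly acyclic if accepted by a weakly acyclic DFA. -}

module Defs where

open import Data.Nat using (ℕ)
open import Data.Fin using (Fin)
open import Data.Bool using (Bool; T)
open import Data.Maybe using (Maybe; just; nothing)
open import Data.List using (List; []; _∷_; map)
open import Data.List.Membership.Propositional using (_∈_)
open import Data.Product using (Σ; _×_; _,_; ∃; proj₁; proj₂)
open import Relation.Binary.PropositionalEquality using (_≡_)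
open import Function.Bundles using (_⇔_)

Word : ℕ → Set
Word k = List (Fin k)

-- A table with nodes Fin m over alphabet Fin k.
-- next q a = nothing  means  q^a = self ;  next q a = just q'  means  q^a = q'.
record Table (k m : ℕ) : Set where
  field
    next : Fin m → Fin k → Maybe (Fin m)
    flag : Fin m → Bool

module _ {k m : ℕ} (Tb : Table k m) where
  open Table Tb

  LTable : Fin m → Word k → Set
  LTable q []      = T (flag q)
  LTable q (a ∷ w) with next q a
  ... | nothing = LTable q w
  ... | just q' = LTable q' w

  succT : Fin m → Fin k → Fin m
  succT q b with next q b
  ... | nothing = q
  ... | just q' = q'

-- A transducer: an NFA over Σ × Σ with states Fin n.
-- δ p a b p'  means  p' ∈ δ(p,(a,b)).
record Transducer (k n : ℕ) : Set where
  field
    δ  : Fin n → Fin k → Fin k → Fin n → Bool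
    p₀ : Fin n
    F  : Fin n → Bool

module _ {k n : ℕ} (Tr : Transducer k n) where
  open Transducer Tr

  AccT : Fin n → List (Fin k × Fin k) → Set
  AccT p []            = T (F p)
  AccT p ((a , b) ∷ w) = Σ (Fin n) λ p' → T (δ p a b p') × AccT p' w

  LTrans : Fin n → Word k → Word k → Set
  LTrans p u v = Σ (List (Fin k × Fin k)) λ w →
    AccT p w × map proj₁ w ≡ u × map proj₂ w ≡ v

Pre : {k : ℕ} → (Word k → Word k → Set) → (Word k → Set) → Word k → Set
Pre {k} R L u = Σ (Word k) λ v → R u v × L v

-- Sets of pairs (p,q) as predicates on Fin n × Fin m (automatically finite).
PairSet : ℕ → ℕ → Set₁
PairSet n m = Fin n → Fin m → Set

_≐_ : {n m : ℕ} → PairSet n m → PairSet n m → Set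
_≐_ {n} {m} S S' = (p : Fin n) (q : Fin m) → S p q ⇔ S' p q

_≈L_ : {k : ℕ} → (Word k → Set) → (Word k → Set) → Set
_≈L_ {k} L L' = (u : Word k) → L u ⇔ L' u

module _ {k n m : ℕ} (Tr : Transducer k n) (Tb : Table k m) where
  open Transducer Tr

  LSet : PairSet n m → Word k → Set
  LSet S u = Σ (Fin n) λ p → Σ (Fin m) λ q →
    S p q × Pre (LTrans Tr p) (LTable Tb q) u

  step : PairSet n m → Fin k → PairSet n m
  step S a p' q' = Σ (Fin n) λ p → Σ (Fin m) λ q → Σ (Fin k) λ b →
    S p q × T (δ p a b p') × q' ≡ succT Tb q b

  _⟶[_]_ : PairSet n m → Fin k → PairSet n m → Set
  S ⟶[ a ] S' = S' ≐ step S a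

  data _⟶*[_]_ : PairSet n m → Word k → PairSet n m → Set₁ where
    ε-step : ∀ {S} → S ⟶*[ [] ] S
    ∷-step : ∀ {S S₁ S' a w} → S ⟶[ a ] S₁ → S₁ ⟶*[ w ] S' → S ⟶*[ a ∷ w ] S'

  _⟶*_ : PairSet n m → PairSet n m → Set₁
  S ⟶* S' = Σ (Word k) λ w → S ⟶*[ w ] S'

record DFA (k r : ℕ) : Set where
  field
    δ' : Fin r → Fin k → Fin r
    q₀ : Fin r
    F' : Fin r → Bool

module _ {k r : ℕ} (A : DFA k r) where
  open DFA A

  δ'* : Fin r → Word k → Fin r
  δ'* q []      = q
  δ'* q (a ∷ w) = δ'* (δ' q a) w

  accepts : Word k → Set
  accepts w = T (F' (δ'* q₀ w))

  IsWeaklyAcyclic : Set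
  IsWeaklyAcyclic = (q : Fin r) (c : Fin k) (w : Word k) →
    c ∈ w → δ'* q w ≡ q → δ' q c ≡ q

WeaklyAcyclicLang : {k : ℕ} → (Word k → Set) → Set
WeaklyAcyclicLang {k} L = Σ ℕ λ r → Σ (DFA k r) λ A →
  IsWeaklyAcyclic A × (L ≈L accepts A)

-- S' ⟶[y] S ⟶[a] S' says that L(S') is invariant under the left quotient by z = y a,
-- and L(S') is itself a left quotient of the weakly acyclic language L(S₀), i.e. the
-- language of a state q of a weakly acyclic DFA.  Among the states q·zⁱ two coincide,
-- so some q·zⁱ lies on a nonempty cycle reading a power of z; weak acyclicity makes
-- every letter of z, hence of y, a self-loop there.  Therefore y⁻¹L(S') = L(S'),
-- and y⁻¹L(S') = L(S) since S' ⟶[y] S.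
module Submission where

open import Defs
open import Data.Nat using (ℕ; zero; suc; _+_)
open import Data.Nat.Properties using (n<1+n; +-suc; m≤n⇒∃[o]m+o≡n)
open import Data.Fin using (Fin; toℕ)
open import Data.Fin.Properties using (pigeonhole)
open import Data.Bool using (T)
open import Data.Maybe using (just; nothing)
open import Data.List using ([]; _∷_; map; _++_; [_])
open import Data.List.Properties using (++-assoc)
open import Data.List.Relation.Unary.Any using (here; there)
open import Data.List.Relation.Binary.Subset.Propositional using (_⊆_)
open import Data.List.Relation.Binary.Subset.Propositional.Properties using (⊆-trans; xs⊆xs++ys)
open import Data.Product using (_,_; ∃₂; proj₂)
open import Function using (id; _∘_)
open import Function.Bundles using (_⇔_; mk⇔; Equivalence)
import Function.Properties.Equivalence as ⇔
open import Level using (0ℓ)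
open import Relation.Binary.PropositionalEquality using (_≡_; refl; sym; trans; cong; subst; module ≡-Reasoning)
import Relation.Binary.Reasoning.Setoid as SetoidReasoning

module ⇔-Reasoning = SetoidReasoning (⇔.⇔-setoid 0ℓ)

infixr 25 _⁻¹_
infixl 30 _^_

_⁻¹_ : {k : ℕ} → Word k → (Word k → Set) → Word k → Set
(w ⁻¹ L) u = L (w ++ u)

_^_ : {k : ℕ} → Word k → ℕ → Word k
z ^ zero  = []
z ^ suc i = z ++ z ^ i

^-distribˡ-+-++ : {k : ℕ} (z : Word k) (i j : ℕ) → z ^ (i + j) ≡ z ^ i ++ z ^ j
^-distribˡ-+-++ z zero    j = refl
^-distribˡ-+-++ z (suc i) j =
  trans (cong (z ++_) (^-distribˡ-+-++ z i j)) (sym (++-assoc z (z ^ i) (z ^ j)))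

≈L-trans : {k : ℕ} {K L M : Word k → Set} → K ≈L L → L ≈L M → K ≈L M
≈L-trans K≈L L≈M u = ⇔.trans (K≈L u) (L≈M u)

⁻¹-fixed-^ : {k : ℕ} {K : Word k → Set} {z : Word k} → K ≈L z ⁻¹ K → (i : ℕ) → K ≈L (z ^ i) ⁻¹ K
⁻¹-fixed-^ K≈z⁻¹K zero    u = ⇔.refl
⁻¹-fixed-^ {K = K} {z} K≈z⁻¹K (suc i) u = begin
  K u                   ≈⟨ ⁻¹-fixed-^ K≈z⁻¹K i u ⟩
  K (z ^ i ++ u)        ≈⟨ K≈z⁻¹K (z ^ i ++ u) ⟩
  K (z ++ z ^ i ++ u)   ≡⟨ cong K (++-assoc z (z ^ i) u) ⟨
  K (z ^ suc i ++ u)    ∎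
  where open ⇔-Reasoning

pigeonhole-ℕ : {r : ℕ} (f : ℕ → Fin r) → ∃₂ λ i d → f (i + suc d) ≡ f i
pigeonhole-ℕ {r} f with pigeonhole (n<1+n r) (f ∘ toℕ)
... | i , j , i<j , fi≡fj with m≤n⇒∃[o]m+o≡n i<j
...   | d , 1+i+d≡j = toℕ i , d , trans (cong f (trans (+-suc (toℕ i) d) 1+i+d≡j)) (sym fi≡fj)

module _ {k r : ℕ} (A : DFA k r) where
  open DFA A

  acceptsFrom : Fin r → Word k → Set
  acceptsFrom q w = T (F' (δ'* A q w))

  δ'*-++ : (q : Fin r) (u v : Word k) → δ'* A q (u ++ v) ≡ δ'* A (δ'* A q u) v
  δ'*-++ q []      v = refl
  δ'*-++ q (c ∷ u) v = δ'*-++ (δ' q c) u v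

  acceptsFrom-++ : (q : Fin r) (u v : Word k) → acceptsFrom q (u ++ v) ≡ acceptsFrom (δ'* A q u) v
  acceptsFrom-++ q u v = cong (T ∘ F') (δ'*-++ q u v)

  δ'*-^-cycle : (q : Fin r) (z : Word k) →
    ∃₂ λ i d → δ'* A (δ'* A q (z ^ i)) (z ^ suc d) ≡ δ'* A q (z ^ i)
  δ'*-^-cycle q z with pigeonhole-ℕ (λ i → δ'* A q (z ^ i))
  ... | i , d , cycle = i , d , (begin
    δ'* A (δ'* A q (z ^ i)) (z ^ suc d)  ≡⟨ δ'*-++ q (z ^ i) (z ^ suc d) ⟨
    δ'* A q (z ^ i ++ z ^ suc d)         ≡⟨ cong (δ'* A q) (^-distribˡ-+-++ z i (suc d)) ⟨
    δ'* A q (z ^ (i + suc d))            ≡⟨ cycle ⟩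
    δ'* A q (z ^ i)                      ∎)
    where open ≡-Reasoning

  weaklyAcyclic-cycle-fixes : IsWeaklyAcyclic A → {q : Fin r} {w : Word k} (y : Word k) →
    δ'* A q w ≡ q → y ⊆ w → δ'* A q y ≡ q
  weaklyAcyclic-cycle-fixes wa []      cycle y⊆w = refl
  weaklyAcyclic-cycle-fixes wa {q} {w} (c ∷ y) cycle y⊆w =
    trans (cong (λ p → δ'* A p y) (wa q c w (y⊆w (here refl)) cycle))
          (weaklyAcyclic-cycle-fixes wa y cycle (y⊆w ∘ there))

  weaklyAcyclic-⁻¹-absorb : IsWeaklyAcyclic A → {K : Word k → Set} {q : Fin r} {y z : Word k} →
    K ≈L acceptsFrom q → K ≈L z ⁻¹ K → y ⊆ z → y ⁻¹ K ≈L K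
  weaklyAcyclic-⁻¹-absorb wa {K} {q} {y} {z} K≈q K≈z⁻¹K y⊆z v with δ'*-^-cycle q z
  ... | i , d , cycle = begin
    K (y ++ v)                      ≈⟨ ⁻¹-fixed-^ K≈z⁻¹K i (y ++ v) ⟩
    K (z ^ i ++ y ++ v)             ≈⟨ K≈q (z ^ i ++ y ++ v) ⟩
    acceptsFrom q (z ^ i ++ y ++ v) ≡⟨ acceptsFrom-++ q (z ^ i) (y ++ v) ⟩
    acceptsFrom p (y ++ v)          ≡⟨ acceptsFrom-++ p y v ⟩
    acceptsFrom (δ'* A p y) v       ≡⟨ cong (λ p′ → acceptsFrom p′ v) p·y≡p ⟩
    acceptsFrom p v                 ≡⟨ acceptsFrom-++ q (z ^ i) v ⟨
    acceptsFrom q (z ^ i ++ v)      ≈⟨ K≈q (z ^ i ++ v) ⟨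
    K (z ^ i ++ v)                  ≈⟨ ⁻¹-fixed-^ K≈z⁻¹K i v ⟨
    K v                             ∎
    where
    open ⇔-Reasoning
    p : Fin r
    p = δ'* A q (z ^ i)
    p·y≡p : δ'* A p y ≡ p
    p·y≡p = weaklyAcyclic-cycle-fixes wa y cycle (⊆-trans y⊆z (xs⊆xs++ys z (z ^ d)))

WeaklyAcyclicLang-⁻¹-absorb : {k : ℕ} {L K : Word k → Set} {x y z : Word k} →
  WeaklyAcyclicLang L → K ≈L x ⁻¹ L → K ≈L z ⁻¹ K → y ⊆ z → y ⁻¹ K ≈L K
WeaklyAcyclicLang-⁻¹-absorb {L = L} {x = x} (r , A , wa , L≈A) K≈x⁻¹L =
  weaklyAcyclic-⁻¹-absorb A wa (≈L-trans K≈x⁻¹L x⁻¹L≈q₀·x)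
  where
  x⁻¹L≈q₀·x : x ⁻¹ L ≈L acceptsFrom A (δ'* A (DFA.q₀ A) x)
  x⁻¹L≈q₀·x v = subst (L (x ++ v) ⇔_) (acceptsFrom-++ A (DFA.q₀ A) x v) (L≈A (x ++ v))

module _ {k n m : ℕ} (Tr : Transducer k n) (Tb : Table k m) where

  LTable-∷ : (q : Fin m) (b : Fin k) (v : Word k) → LTable Tb q (b ∷ v) ≡ LTable Tb (succT Tb q b) v
  LTable-∷ q b v with Table.next Tb q b
  ... | nothing = refl
  ... | just _  = refl

  LSet-⟶ : {S S' : PairSet n m} {a : Fin k} →
    _⟶[_]_ Tr Tb S a S' → LSet Tr Tb S' ≈L [ a ] ⁻¹ LSet Tr Tb S
  LSet-⟶ {S} {S'} {a} S⟶S' u = mk⇔ forward backward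
    where
    forward : ∀ {u} → LSet Tr Tb S' u → LSet Tr Tb S (a ∷ u)
    forward (p' , q' , s' , v , (w , acc , refl , refl) , v∈q') with Equivalence.to (S⟶S' p' q') s'
    ... | p , q , b , s , d , refl =
      p , q , s , b ∷ v , ((a , b) ∷ w , (p' , d , acc) , refl , refl) ,
      subst id (sym (LTable-∷ q b v)) v∈q'
    backward : ∀ {u} → LSet Tr Tb S (a ∷ u) → LSet Tr Tb S' u
    backward (p , q , s , _ , ((_ , b) ∷ w , (p' , d , acc) , refl , refl) , bv∈q) =
      p' , succT Tb q b , Equivalence.from (S⟶S' p' (succT Tb q b)) (p , q , b , s , d , refl) ,
      map proj₂ w , (w , acc , refl , refl) , subst id (LTable-∷ q b _) bv∈q

  ⟶*-++ : {S S₁ S' : PairSet n m} {u v : Word k} →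
    _⟶*[_]_ Tr Tb S u S₁ → _⟶*[_]_ Tr Tb S₁ v S' → _⟶*[_]_ Tr Tb S (u ++ v) S'
  ⟶*-++ ε-step            S₁⟶S' = S₁⟶S'
  ⟶*-++ (∷-step st S⟶S₁) S₁⟶S' = ∷-step st (⟶*-++ S⟶S₁ S₁⟶S')

  LSet-⟶* : {S S' : PairSet n m} {w : Word k} →
    _⟶*[_]_ Tr Tb S w S' → LSet Tr Tb S' ≈L w ⁻¹ LSet Tr Tb S
  LSet-⟶* ε-step                    u = ⇔.refl
  LSet-⟶* (∷-step {w = w} st S₁⟶S') u = ⇔.trans (LSet-⟶* S₁⟶S' u) (LSet-⟶ st (w ++ u))

proposition9 : {k n m : ℕ} (Tr : Transducer k n) (Tb : Table k m)
    (S₀ S S' : PairSet n m) (a : Fin k) →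
    _⟶*_ Tr Tb S₀ S' → _⟶*_ Tr Tb S' S → _⟶[_]_ Tr Tb S a S' →
    WeaklyAcyclicLang (LSet Tr Tb S₀) →
    LSet Tr Tb S ≈L LSet Tr Tb S'
proposition9 Tr Tb S₀ S S' a (x , S₀⟶S') (y , S'⟶S) S⟶S' wa =
  ≈L-trans (LSet-⟶* Tr Tb S'⟶S)
    (WeaklyAcyclicLang-⁻¹-absorb wa (LSet-⟶* Tr Tb S₀⟶S') (LSet-⟶* Tr Tb S'⟶S') (xs⊆xs++ys y [ a ]))
  where
  S'⟶S' : _⟶*[_]_ Tr Tb S' (y ++ [ a ]) S'
  S'⟶S' = ⟶*-++ Tr Tb S'⟶S (∷-step S⟶S' ε-step)
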